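{- There exist uncountably many distinct (pairwise non-isomorphic as rooted trees) trees $T$ all having the same escape sequence $e(T,\mathbf 0)$.
   Context: A tree is an infinite tree with all vertex degrees finite, a distinguished root $\rho$ of degree $1$, and for each non-root vertex $v$ a cyclic order $v^{(0)},v^{(1)},\dots,v^{(b(v))}$ of its neighbours ($v^{(0)}$ the parent). A rotor configuration assigns to each non-root $v$ a value $r(v)\in\{0,\dots,b(v)\}$, meaning the rotor at $v$ points to $v^{(r(v))}$; the rotor at $\rho$ always points to its only child. Rotor walk: at each step the rotor at the particle's current vertex is advanced to the next neighbour in the cyclic order, and the particle moves there. Particles are started one after another at $\rho$: each performs rotor walk until it first returns to $\rho$, or else never returns (it escapes to infinity); the next particle starts with the rotors left by the previous ones. The escape sequence $e(T,r)=(e_1,e_2,\dots)$ has $e_n=1$ if particle $n$ escapes and $0$ otherwise. $\mathbf 0$ is the configuration with all rotors pointing to the parent ($\mathbf 0(v)=0$); for this configuration the escape sequence does not depend on the cyclic orders. -}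

module Defs where

open import Data.Nat using (ℕ; zero; suc; _<_; _≤_; _≡ᵇ_)
open import Data.Bool using (Bool; true; false; if_then_else_)
open import Data.List using (List; []; _∷_)
open import Data.List.Properties using (≡-dec)
open import Data.Product using (Σ; _×_; ∃; _,_; proj₁; proj₂)
open import Relation.Binary.PropositionalEquality using (_≡_; _≢_)
open import Relation.Nullary using (does)
open import Function.Definitions using (Injective)
open import Function.Bundles using (_↔_; _⇔_; Inverse)
open import Data.Sum using (_⊎_)
import Data.Nat as N

-- A rooted locally finite tree is encoded by a branching function
-- br : List ℕ → ℕ.  Non-root vertices are "addresses": [] is the unique
-- child of the root ρ, and (i ∷ xs) is the i-th child (i < br xs) of xs.
-- br xs = b(v) is the number of children of the vertex v with address xs.
-- Cyclic order at v = xs : index 0 = parent, index (suc i) = child i.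

data Valid (br : List ℕ → ℕ) : List ℕ → Set where
  vtop   : Valid br []
  vchild : ∀ {i xs} → Valid br xs → i < br xs → Valid br (i ∷ xs)

data Vtx (br : List ℕ → ℕ) : Set where
  ρ  : Vtx br
  nd : (xs : List ℕ) → Valid br xs → Vtx br

data Par {br : List ℕ → ℕ} : Vtx br → Vtx br → Set where
  par-root : ∀ {p} → Par ρ (nd [] p)
  par-nd   : ∀ {i xs p q} → Par (nd xs p) (nd (i ∷ xs) q)

Adj : {br : List ℕ → ℕ} → Vtx br → Vtx br → Set
Adj u v = Par u v ⊎ Par v u

-- a tree: infinite (infinitely many vertices), locally finite, root of degree 1
record Tree : Set where
  field
    br       : List ℕ → ℕ
    infinite : Σ (ℕ → Vtx br) (Injective _≡_ _≡_)
open Tree public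

record Iso (T T' : Tree) : Set where
  field
    bij   : Vtx (br T) ↔ Vtx (br T')
    root↦ : Inverse.to bij ρ ≡ ρ
    adj   : ∀ u v → Adj u v ⇔ Adj (Inverse.to bij u) (Inverse.to bij v)

Config : Set
Config = List ℕ → ℕ   -- r(v) ∈ {0,…,b(v)} at address v

zeroConfig : Config
zeroConfig _ = 0

data Pos : Set where
  root : Pos
  at   : List ℕ → Pos

State : Set
State = Config × Pos

advance : (List ℕ → ℕ) → Config → List ℕ → ℕ
advance br r xs = if r xs ≡ᵇ br xs then 0 else suc (r xs)

update : Config → List ℕ → ℕ → Config
update r xs k ys = if does (≡-dec N._≟_ ys xs) then k else r ys

parentPos : List ℕ → Pos
parentPos []       = root
parentPos (_ ∷ ys) = at ys

nbr : List ℕ → ℕ → Pos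
nbr xs zero    = parentPos xs
nbr xs (suc i) = at (i ∷ xs)

-- one step of rotor walk (the rotor at ρ always points to its only child)
step : (List ℕ → ℕ) → State → State
step br (r , root) = (r , at [])
step br (r , at xs) = let k = advance br r xs in (update r xs k , nbr xs k)

run : (List ℕ → ℕ) → Config → ℕ → State
run br r zero    = (r , root)
run br r (suc t) = step br (run br r t)

pos : State → Pos
pos = proj₂

cfg : State → Config
cfg = proj₁

FirstReturn : (List ℕ → ℕ) → Config → ℕ → Set
FirstReturn br r t = (0 < t) × (pos (run br r t) ≡ root)
                   × (∀ s → 0 < s → s < t → pos (run br r s) ≢ root)

-- one particle started with rotors r: escape bit e and resulting rotors r'
-- (for an escaping particle, r' is the pointwise eventual value of the rotors)
ParticleStep : (List ℕ → ℕ) → Config → Bool → Config → Set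
ParticleStep br r false r' =
  Σ ℕ λ t → FirstReturn br r t × (∀ xs → r' xs ≡ cfg (run br r t) xs)
ParticleStep br r true r' =
  (∀ t → 0 < t → pos (run br r t) ≢ root)
  × (∀ xs → Σ ℕ λ t₀ → ∀ t → t₀ ≤ t → cfg (run br r t) xs ≡ r' xs)

record EscSeq (T : Tree) (r₀ : Config) (e : ℕ → Bool) : Set where
  field
    R     : ℕ → Config
    R₀    : ∀ xs → R 0 xs ≡ r₀ xs
    Rstep : ∀ n → ParticleStep (br T) (R n) (e n) (R (suc n))

-- The comb of a : ℕ → Bool is an infinite spine whose vertex at depth k carries one
-- extra leaf exactly when a k holds.  From the all-parent configuration the first
-- particle runs down the spine forever, turning every spine rotor down the spine.
-- Particle n + 2 then finds the rotors turned to the parent exactly at depths < n: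
-- it runs down to depth n and climbs back to ρ (a leaf only delays it by two steps),
-- leaving them turned to the parent exactly at depths ≤ n.  So every comb has
-- escape sequence 1, 0, 0, …, while an isomorphism of combs maps the spine onto the
-- spine, hence leaves onto leaves, and so recovers a.

module Submission where

open import Defs
open import Data.Nat using (ℕ; zero; suc; _+_; _<_; _≤_; z≤n; s≤s; _≟_; _<?_)
open import Data.Nat.Properties
open import Data.Nat.GeneralisedArithmetic using (fold; iterate; iterate-is-fold)
open import Data.Bool using (Bool; true; false; if_then_else_)
open import Data.Bool.Properties using (⇔→≡)
open import Data.Maybe using (Maybe; just; nothing; maybe′)
import Data.Maybe as Maybe
open import Data.List using (List; []; _∷_)
open import Data.List.Properties using (≡-dec; ∷-injectiveʳ)
open import Data.Product using (Σ; _×_; _,_; proj₁; proj₂)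
open import Data.Sum using (_⊎_; inj₁; inj₂)
open import Data.Empty using (⊥-elim)
open import Function using (const; _∘_)
open import Function.Definitions using (Injective)
open import Function.Bundles using (Inverse; Equivalence; mk⇔)
open import Function.Properties.Inverse using (↔-sym)
open import Relation.Nullary using (yes; no; contradiction)
open import Relation.Nullary.Decidable using (dec-true; dec-false)
open import Relation.Binary.Definitions using (tri<; tri≈; tri>)
open import Relation.Binary.PropositionalEquality

private variable
  A : Set
  b : List ℕ → ℕ
  a : ℕ → Bool
  g : ℕ → ℕ
  j k n m : ℕ
  r r' : Config
  xs : List ℕ
  x x' y y' z : State

Eventually : (ℕ → Set) → Set
Eventually P = Σ ℕ λ t₀ → ∀ t → t₀ ≤ t → P t

_[_]≔_ : (ℕ → A) → ℕ → A → ℕ → A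
(g [ j ]≔ v) k with k ≟ j
... | yes _ = v
... | no  _ = g k

[]≔-same : ∀ (g : ℕ → A) j v → (g [ j ]≔ v) j ≡ v
[]≔-same g j v with j ≟ j
... | yes _   = refl
... | no  j≢j = contradiction refl j≢j

[]≔-other : ∀ (g : ℕ → A) {j} v {k} → k ≢ j → (g [ j ]≔ v) k ≡ g k
[]≔-other g {j} v {k} k≢j with k ≟ j
... | yes k≡j = contradiction k≡j k≢j
... | no  _   = refl

[]≔-idem : ∀ (g : ℕ → A) j v w → (g [ j ]≔ v) [ j ]≔ w ≗ g [ j ]≔ w
[]≔-idem g j v w k with k ≟ j
... | yes _   = refl
... | no  k≢j = []≔-other g v k≢j

override : ℕ → (ℕ → A) → (ℕ → A) → ℕ → A
override n f g k with k <? n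
... | yes _ = f k
... | no  _ = g k

override-below : ∀ n (f g : ℕ → A) → k < n → override n f g k ≡ f k
override-below {k = k} n f g k<n with k <? n
... | yes _   = refl
... | no  k≮n = contradiction k<n k≮n

override-above : ∀ n (f g : ℕ → A) → n ≤ k → override n f g k ≡ g k
override-above {k = k} n f g n≤k with k <? n
... | yes k<n = contradiction n≤k (<⇒≱ k<n)
... | no  _   = refl

override-extend : ∀ n (f g : ℕ → A) → override n f g [ n ]≔ f n ≗ override (suc n) f g
override-extend n f g k with <-cmp k n
... | tri< k<n k≢n _ = begin
  (override n f g [ n ]≔ f n) k  ≡⟨ []≔-other _ _ k≢n ⟩
  override n f g k               ≡⟨ override-below n f g k<n ⟩
  f k                            ≡⟨ override-below (suc n) f g (m<n⇒m<1+n k<n) ⟨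
  override (suc n) f g k         ∎
  where open ≡-Reasoning
... | tri≈ _ refl _ = trans ([]≔-same _ n _) (sym (override-below (suc n) f g (n<1+n n)))
... | tri> _ k≢n n<k = begin
  (override n f g [ n ]≔ f n) k  ≡⟨ []≔-other _ _ k≢n ⟩
  override n f g k               ≡⟨ override-above n f g (<⇒≤ n<k) ⟩
  g k                            ≡⟨ override-above (suc n) f g n<k ⟨
  override (suc n) f g k         ∎
  where open ≡-Reasoning

override-absorb : ∀ n (f g : ℕ → A) → override n f (g [ n ]≔ f n) ≗ override (suc n) f g
override-absorb n f g k with <-cmp k n
... | tri< k<n _ _ = trans (override-below n f _ k<n) (sym (override-below (suc n) f g (m<n⇒m<1+n k<n)))
... | tri≈ _ refl _ = begin
  override n f (g [ n ]≔ f n) n  ≡⟨ override-above n f _ ≤-refl ⟩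
  (g [ n ]≔ f n) n               ≡⟨ []≔-same g n _ ⟩
  f n                            ≡⟨ override-below (suc n) f g (n<1+n n) ⟨
  override (suc n) f g n         ∎
  where open ≡-Reasoning
... | tri> _ k≢n n<k = begin
  override n f (g [ n ]≔ f n) k  ≡⟨ override-above n f _ (<⇒≤ n<k) ⟩
  (g [ n ]≔ f n) k               ≡⟨ []≔-other g _ k≢n ⟩
  g k                            ≡⟨ override-above (suc n) f g n<k ⟨
  override (suc n) f g k         ∎
  where open ≡-Reasoning

spine : ℕ → List ℕ
spine zero    = []
spine (suc k) = 0 ∷ spine k

spineDepth : List ℕ → Maybe ℕ
spineDepth []          = just 0
spineDepth (zero ∷ xs) = Maybe.map suc (spineDepth xs)
spineDepth (suc _ ∷ _) = nothing

spineDepth-spine : ∀ k → spineDepth (spine k) ≡ just k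
spineDepth-spine zero    = refl
spineDepth-spine (suc k) = cong (Maybe.map suc) (spineDepth-spine k)

spineDepth⇒spine : ∀ {xs k} → spineDepth xs ≡ just k → xs ≡ spine k
spineDepth⇒spine {[]}        refl = refl
spineDepth⇒spine {zero ∷ xs} eq with spineDepth xs in e
spineDepth⇒spine {zero ∷ xs} refl | just _ = cong (0 ∷_) (spineDepth⇒spine e)

onSpine : (ℕ → ℕ) → List ℕ → ℕ
onSpine g xs = maybe′ g 0 (spineDepth xs)

onSpine-converges : {gs : ℕ → ℕ → ℕ} {h : ℕ → ℕ} → (∀ k → Eventually λ t → gs t k ≡ h k) →
                    ∀ xs → Eventually λ t → onSpine (gs t) xs ≡ onSpine h xs
onSpine-converges conv xs with spineDepth xs
... | nothing = 0 , λ _ _ → refl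
... | just k  = conv k

onSpine-spine : ∀ g k → onSpine g (spine k) ≡ g k
onSpine-spine g k rewrite spineDepth-spine k = refl

onSpine-cong : ∀ {g h} → g ≗ h → onSpine g ≗ onSpine h
onSpine-cong g≗h xs with spineDepth xs
... | nothing = refl
... | just k  = g≗h k

onSpine-zero : onSpine (const 0) ≗ zeroConfig
onSpine-zero xs with spineDepth xs
... | nothing = refl
... | just _  = refl

update-onSpine : ∀ g j v → update (onSpine g) (spine j) v ≗ onSpine (g [ j ]≔ v)
update-onSpine g j v ys with ≡-dec _≟_ ys (spine j)
... | yes refl = sym (trans (onSpine-spine _ j) ([]≔-same g j v))
... | no ys≢spine with spineDepth ys in e
...   | nothing = refl
...   | just k  = sym ([]≔-other g v λ k≡j → ys≢spine (trans (spineDepth⇒spine e) (cong spine k≡j)))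

update-onSpine-off : ∀ g xs → update (onSpine g) (1 ∷ xs) 0 ≗ onSpine g
update-onSpine-off g xs ys with ≡-dec _≟_ ys (1 ∷ xs)
... | yes refl = refl
... | no  _    = refl

spine-injective : ∀ {m n} → spine m ≡ spine n → m ≡ n
spine-injective {zero}  {zero}  _  = refl
spine-injective {suc m} {suc n} eq = cong suc (spine-injective (∷-injectiveʳ eq))

1∷≢spine : ∀ n → 1 ∷ xs ≢ spine n
1∷≢spine zero    ()
1∷≢spine (suc n) ()

advance-wrap : r xs ≡ b xs → advance b r xs ≡ 0
advance-wrap {r} {xs} {b} e = cong (λ c → if c then 0 else suc (r xs)) (dec-true (r xs ≟ b xs) e)

advance-turn : r xs ≢ b xs → advance b r xs ≡ suc (r xs)
advance-turn {r} {xs} {b} e = cong (λ c → if c then 0 else suc (r xs)) (dec-false (r xs ≟ b xs) e)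

-- Rotor configurations are functions, so states are compared pointwise.
infix 4 _≋_
_≋_ : State → State → Set
x ≋ y = cfg x ≗ cfg y × pos x ≡ pos y

≋-refl : x ≋ x
≋-refl = (λ _ → refl) , refl

≋-trans : x ≋ y → y ≋ z → x ≋ z
≋-trans (c , p) (c' , p') = (λ xs → trans (c xs) (c' xs)) , trans p p'

update-cong : ∀ xs k → r ≗ r' → update r xs k ≗ update r' xs k
update-cong xs k r≗r' ys with ≡-dec _≟_ ys xs
... | yes _ = refl
... | no  _ = r≗r' ys

step-cong : ∀ b {x y} → x ≋ y → step b x ≋ step b y
step-cong b {r , root}  (r≗r' , refl) = r≗r' , refl
step-cong b {r , at xs} (r≗r' , refl) rewrite r≗r' xs = update-cong xs _ r≗r' , refl

data Walk (b : List ℕ → ℕ) : State → ℕ → State → Set where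
  stop : x ≋ y → Walk b x 0 y
  next : pos x ≢ root → Walk b (step b x) n y → Walk b x (suc n) y

walk-resp : x ≋ x' → Walk b x' n y → Walk b x n y
walk-resp x≋x' (stop x'≋y)  = stop (≋-trans x≋x' x'≋y)
walk-resp x≋x' (next x'∉ρ w) =
  next (λ x∈ρ → x'∉ρ (trans (sym (proj₂ x≋x')) x∈ρ)) (walk-resp (step-cong _ x≋x') w)

walk-respʳ : Walk b x n y → y ≋ y' → Walk b x n y'
walk-respʳ (stop x≋y)  y≋y' = stop (≋-trans x≋y y≋y')
walk-respʳ (next x∉ρ w) y≋y' = next x∉ρ (walk-respʳ w y≋y')

walk-step : pos x ≢ root → step b x ≋ x' → Walk b x' n y → Walk b x (suc n) y
walk-step x∉ρ e w = next x∉ρ (walk-resp e w)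

walk-++ : Walk b x n y → Walk b y m z → Walk b x (n + m) z
walk-++ (stop x≋y)   w = walk-resp x≋y w
walk-++ (next x∉ρ v) w = next x∉ρ (walk-++ v w)

walk-snoc : Walk b x n y → pos y ≢ root → step b y ≋ z → Walk b x (suc n) z
walk-snoc (stop x≋y)   y∉ρ e = walk-step (λ x∈ρ → y∉ρ (trans (sym (proj₂ x≋y)) x∈ρ))
                                         (≋-trans (step-cong _ x≋y) e) (stop ≋-refl)
walk-snoc (next x∉ρ w) y∉ρ e = next x∉ρ (walk-snoc w y∉ρ e)

walk-end : Walk b x n y → iterate (step b) x n ≋ y
walk-end (stop x≋y) = x≋y
walk-end (next _ w) = walk-end w

walk-avoids : Walk b x n y → ∀ {m} → m < n → pos (iterate (step b) x m) ≢ root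
walk-avoids (next x∉ρ w) {zero}  _         = x∉ρ
walk-avoids (next x∉ρ w) {suc m} (s≤s m<n) = walk-avoids w m<n

run≡iterate : ∀ b r t → run b r t ≡ iterate (step b) (r , root) t
run≡iterate b r t = trans (run≡fold t) (iterate-is-fold _ (step b) t)
  where
  run≡fold : ∀ t → run b r t ≡ fold (r , root) (step b) t
  run≡fold zero    = refl
  run≡fold (suc t) = cong (step b) (run≡fold t)

returns : Walk b (r , at []) n (r' , root) → ParticleStep b r false r'
returns {b} {r} {n} w = suc n , (s≤s z≤n , returned , avoids) , λ xs → sym (proj₁ end xs)
  where
  end : run b r (suc n) ≋ (_ , root)
  end = subst (_≋ _) (sym (run≡iterate b r (suc n))) (walk-end w)
  returned : pos (run b r (suc n)) ≡ root
  returned = proj₂ end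
  avoids : ∀ s → 0 < s → s < suc n → pos (run b r s) ≢ root
  avoids (suc s) _ (s≤s s<n) rewrite run≡iterate b r (suc s) = walk-avoids w s<n

escapes : (ends : ℕ → State) → (∀ t → Walk b (r , at []) t (ends t)) →
          (∀ xs → Eventually λ t → cfg (ends t) xs ≡ r' xs) → ParticleStep b r true r'
escapes {b} {r} {r'} ends walks converges = avoids , stabilises
  where
  avoids : ∀ t → 0 < t → pos (run b r t) ≢ root
  avoids (suc t) _ rewrite run≡iterate b r (suc t) = walk-avoids (walks (suc t)) ≤-refl
  stabilises : ∀ xs → Eventually λ t → cfg (run b r t) xs ≡ r' xs
  stabilises xs with converges xs
  ... | t₀ , conv = suc t₀ , eventually
    where
    open ≡-Reasoning
    eventually : ∀ t → suc t₀ ≤ t → cfg (run b r t) xs ≡ r' xs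
    eventually (suc t) (s≤s t₀≤t) = begin
      cfg (run b r (suc t)) xs                 ≡⟨ cong (λ s → cfg s xs) (run≡iterate b r (suc t)) ⟩
      cfg (iterate (step b) (r , at []) t) xs  ≡⟨ proj₁ (walk-end (walks t)) xs ⟩
      cfg (ends t) xs                          ≡⟨ conv t t₀≤t ⟩
      r' xs                                    ∎

-- Rotor value 0 points to the parent, 1 down the spine and 2 to the leaf.
arity : (ℕ → Bool) → ℕ → ℕ
arity a k = if a k then 2 else 1

combBranching : (ℕ → Bool) → List ℕ → ℕ
combBranching a = onSpine (arity a)

arity-leaf : ∀ a k → a k ≡ true → arity a k ≡ 2
arity-leaf a k = cong (if_then 2 else 1)

arity-noLeaf : ∀ a k → a k ≡ false → arity a k ≡ 1
arity-noLeaf a k = cong (if_then 2 else 1)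

arity-pos : ∀ a k → 0 < arity a k
arity-pos a k with a k
... | true  = s≤s z≤n
... | false = s≤s z≤n

step-spine-wrap : g j ≡ arity a j →
  step (combBranching a) (onSpine g , at (spine j)) ≋ (onSpine (g [ j ]≔ 0) , parentPos (spine j))
step-spine-wrap {g} {j} {a} e
  rewrite advance-wrap {onSpine g} {spine j} {combBranching a}
            (trans (onSpine-spine g j) (trans e (sym (onSpine-spine (arity a) j))))
  = update-onSpine g j 0 , refl

step-spine-turn : ∀ {i} → g j ≡ i → i ≢ arity a j →
  step (combBranching a) (onSpine g , at (spine j)) ≋ (onSpine (g [ j ]≔ suc i) , at (i ∷ spine j))
step-spine-turn {g} {j} {a} refl i≢arity
  rewrite advance-turn {onSpine g} {spine j} {combBranching a}
            (λ e → i≢arity (trans (sym (onSpine-spine g j)) (trans e (onSpine-spine (arity a) j))))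
        | onSpine-spine g j
  = update-onSpine g j _ , refl

step-leaf : step (combBranching a) (onSpine g , at (1 ∷ spine j)) ≋ (onSpine g , at (spine j))
step-leaf {a} {g} {j} = update-onSpine-off g (spine j) , refl

passTime : (ℕ → Bool) → ℕ → ℕ
passTime a k = if a k then 3 else 1

walk-up : g j ≡ 1 →
  Walk (combBranching a) (onSpine g , at (spine j)) (passTime a j)
       (onSpine (g [ j ]≔ 0) , parentPos (spine j))
walk-up {g} {j} {a} g≡1 with a j in aj
... | false = walk-step (λ ()) (step-spine-wrap (trans g≡1 (sym (arity-noLeaf a j aj)))) (stop ≋-refl)
... | true  =
  walk-step (λ ()) (step-spine-turn g≡1 1≢arity) (
  walk-step (λ ()) (step-leaf {a = a}) (
  walk-step (λ ()) (step-spine-wrap (trans ([]≔-same g j 2) (sym (arity-leaf a j aj)))) (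
  stop (onSpine-cong ([]≔-idem g j 2 0) , refl))))
  where
  1≢arity : 1 ≢ arity a j
  1≢arity 1≡arity = contradiction (trans 1≡arity (arity-leaf a j aj)) λ ()

descend : ∀ a n g → (∀ k → k < n → g k ≡ 0) →
  Walk (combBranching a) (onSpine g , at []) n (onSpine (override n (const 1) g) , at (spine n))
descend a zero    g _     = stop (onSpine-cong (λ k → sym (override-above {k = k} 0 (const 1) g z≤n)) , refl)
descend a (suc n) g zeros =
  walk-snoc (descend a n g λ k k<n → zeros k (m<n⇒m<1+n k<n)) (λ ())
    (≋-trans (step-spine-turn (trans (override-above n _ g ≤-refl) (zeros n (n<1+n n)))
                              (<⇒≢ (arity-pos a n)))
             (onSpine-cong (override-extend n (const 1) g) , refl))

ascentTime : (ℕ → Bool) → ℕ → ℕ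
ascentTime a zero    = passTime a 0
ascentTime a (suc j) = passTime a (suc j) + ascentTime a j

ascend : ∀ a j g → (∀ k → k ≤ j → g k ≡ 1) →
  Walk (combBranching a) (onSpine g , at (spine j)) (ascentTime a j)
       (onSpine (override (suc j) (const 0) g) , root)
ascend a zero    g ones =
  walk-respʳ (walk-up (ones 0 z≤n))
    (onSpine-cong (λ k → trans (sym (override-above {k = k} 0 (const 0) (g [ 0 ]≔ 0) z≤n))
                               (override-absorb 0 (const 0) g k)) , refl)
ascend a (suc j) g ones =
  walk-++ (walk-up (ones (suc j) ≤-refl))
    (walk-respʳ (ascend a j (g [ suc j ]≔ 0) ones')
      (onSpine-cong (override-absorb (suc j) (const 0) g) , refl))
  where
  ones' : ∀ k → k ≤ j → (g [ suc j ]≔ 0) k ≡ 1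
  ones' k k≤j = trans ([]≔-other g 0 (<⇒≢ (s≤s k≤j))) (ones k (m≤n⇒m≤1+n k≤j))

spineRotors : ℕ → ℕ → ℕ
spineRotors zero    = const 0
spineRotors (suc m) = override m (const 0) (const 1)

escapeSeq : ℕ → Bool
escapeSeq zero    = true
escapeSeq (suc _) = false

first-escapes : ∀ a → ParticleStep (combBranching a) (onSpine (spineRotors 0)) true (onSpine (spineRotors 1))
first-escapes a =
  escapes (λ t → onSpine (override t (const 1) (const 0)) , at (spine t))
          (λ t → descend a t (const 0) λ _ _ → refl)
          (onSpine-converges pointsDown)
  where
  pointsDown : ∀ k → Eventually λ t → override t (const 1) (const 0) k ≡ spineRotors 1 k
  pointsDown k = suc k , λ t k<t →
    trans (override-below t _ _ k<t) (sym (override-above {k = k} 0 (const 0) (const 1) z≤n))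

later-returns : ∀ a m → ParticleStep (combBranching a) (onSpine (spineRotors (suc m))) false
                                                     (onSpine (spineRotors (suc (suc m))))
later-returns a m =
  returns (walk-++ (walk-respʳ (descend a m (spineRotors (suc m)) λ k k<m → override-below m _ _ k<m)
                               (onSpine-cong allDown , refl))
                   (ascend a m (const 1) λ _ _ → refl))
  where
  allDown : override m (const 1) (spineRotors (suc m)) ≗ const 1
  allDown k with <-≤-connex k m
  ... | inj₁ k<m = override-below m _ _ k<m
  ... | inj₂ m≤k = trans (override-above m _ _ m≤k) (override-above m _ _ m≤k)

Valid-irrelevant : (p q : Valid b xs) → p ≡ q
Valid-irrelevant vtop          vtop          = refl
Valid-irrelevant (vchild p i<) (vchild q i<′) = cong₂ vchild (Valid-irrelevant p q) (<-irrelevant i< i<′)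

nd-irrelevant : (p q : Valid b xs) → nd xs p ≡ nd xs q
nd-irrelevant p q = cong (nd _) (Valid-irrelevant p q)

nd-injective : ∀ {xs ys} {p : Valid b xs} {q : Valid b ys} → nd xs p ≡ nd ys q → xs ≡ ys
nd-injective refl = refl

spineValid : ∀ a k → Valid (combBranching a) (spine k)
spineValid a zero    = vtop
spineValid a (suc k) = vchild (spineValid a k) (subst (0 <_) (sym (onSpine-spine (arity a) k)) (arity-pos a k))

leafValid : ∀ a k → a k ≡ true → Valid (combBranching a) (1 ∷ spine k)
leafValid a k e =
  vchild (spineValid a k) (subst (1 <_) (sym (trans (onSpine-spine (arity a) k) (arity-leaf a k e))) ≤-refl)

spineVtx : ∀ a → ℕ → Vtx (combBranching a)
spineVtx a k = nd (spine k) (spineValid a k)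

leafVtx : ∀ a k → a k ≡ true → Vtx (combBranching a)
leafVtx a k e = nd (1 ∷ spine k) (leafValid a k e)

spineParent : ∀ a → ℕ → Vtx (combBranching a)
spineParent a zero    = ρ
spineParent a (suc k) = spineVtx a k

spineVtx-injective : ∀ a → Injective _≡_ _≡_ (spineVtx a)
spineVtx-injective a = spine-injective ∘ nd-injective

comb : (ℕ → Bool) → Tree
comb a = record { br = combBranching a ; infinite = spineVtx a , spineVtx-injective a }

comb-escapeSeq : ∀ a → EscSeq (comb a) zeroConfig escapeSeq
comb-escapeSeq a = record
  { R     = onSpine ∘ spineRotors
  ; R₀    = onSpine-zero
  ; Rstep = λ where
      zero    → first-escapes a
      (suc m) → later-returns a m
  }

childIndex : ∀ a k {i} → i < arity a k → i ≡ 0 ⊎ (i ≡ 1 × a k ≡ true)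
childIndex a k i<arity with a k
childIndex a k i<arity | false with i<arity
... | s≤s z≤n = inj₁ refl
childIndex a k i<arity | true with i<arity
... | s≤s z≤n       = inj₁ refl
... | s≤s (s≤s z≤n) = inj₂ (refl , refl)

root-neighbour : ∀ a {v} → Adj {combBranching a} ρ v → v ≡ spineVtx a 0
root-neighbour a (inj₁ par-root) = nd-irrelevant _ _

spine-neighbour : ∀ a n {v} → Adj (spineVtx a n) v →
  v ≡ spineParent a n ⊎ v ≡ spineVtx a (suc n) ⊎ Σ (a n ≡ true) λ e → v ≡ leafVtx a n e
spine-neighbour a n (inj₁ (par-nd {q = vchild _ i<}))
  with childIndex a n (subst (_ <_) (onSpine-spine (arity a) n) i<)
... | inj₁ refl       = inj₂ (inj₁ (nd-irrelevant _ _))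
... | inj₂ (refl , e) = inj₂ (inj₂ (e , nd-irrelevant _ _))
spine-neighbour a zero    (inj₂ par-root) = inj₁ refl
spine-neighbour a (suc n) (inj₂ par-nd)   = inj₁ (nd-irrelevant _ _)

leaf-neighbour : ∀ a n e {v} → Adj (leafVtx a n e) v → v ≡ spineVtx a n
leaf-neighbour a n e (inj₁ (par-nd {q = vchild _ ()}))
leaf-neighbour a n e (inj₂ par-nd) = nd-irrelevant _ _

leaf≢spine : ∀ a k e n → leafVtx a k e ≢ spineVtx a n
leaf≢spine a k e n = 1∷≢spine n ∘ nd-injective

leaf≢parent : ∀ a k e n → leafVtx a k e ≢ spineParent a n
leaf≢parent a k e zero    ()
leaf≢parent a k e (suc n) = leaf≢spine a k e n

spine≢parent : ∀ a n → spineVtx a (suc n) ≢ spineParent a n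
spine≢parent a zero    ()
spine≢parent a (suc n) = >⇒≢ (m<n⇒m<1+n (n<1+n n)) ∘ spineVtx-injective a

Iso-sym : ∀ {T T′} → Iso T T′ → Iso T′ T
Iso-sym I = record
  { bij   = ↔-sym bij
  ; root↦ = trans (cong from (sym root↦)) (strictlyInverseʳ ρ)
  ; adj   = λ u v → let E = adj (from u) (from v) in mk⇔
      (λ uv → Equivalence.from E (subst₂ Adj (sym (strictlyInverseˡ u)) (sym (strictlyInverseˡ v)) uv))
      (λ fuv → subst₂ Adj (strictlyInverseˡ u) (strictlyInverseˡ v) (Equivalence.to E fuv))
  }
  where open Iso I; open Inverse bij

module _ {a a′ : ℕ → Bool} (I : Iso (comb a) (comb a′)) where
  open Iso I
  open Inverse bij using (to; from; strictlyInverseʳ)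

  private
    to-injective : ∀ {u v} → to u ≡ to v → u ≡ v
    to-injective {u} {v} eq = trans (sym (strictlyInverseʳ u)) (trans (cong from eq) (strictlyInverseʳ v))

    adj-image : ∀ {u v w} → Adj u v → to u ≡ w → Adj w (to v)
    adj-image {u} {v} uv refl = Equivalence.to (adj u v) uv

  iso-spine : ∀ n → to (spineVtx a n) ≡ spineVtx a′ n
  iso-parent : ∀ n → to (spineParent a n) ≡ spineParent a′ n

  iso-spine zero = root-neighbour a′ (adj-image (inj₁ par-root) root↦)
  iso-spine (suc n) with spine-neighbour a′ n (adj-image (inj₁ par-nd) (iso-spine n))
  ... | inj₁ e             = ⊥-elim (spine≢parent a n (to-injective (trans e (sym (iso-parent n)))))
  ... | inj₂ (inj₁ e)      = e
  ... | inj₂ (inj₂ (_ , e)) =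
    ⊥-elim (spine≢parent a (suc n) (to-injective (trans (leaf-neighbour a′ n _ (adj-image (inj₁ par-nd) e))
                                                        (sym (iso-spine n)))))

  iso-parent zero    = root↦
  iso-parent (suc n) = iso-spine n

  iso-leaf : ∀ n → a n ≡ true → a′ n ≡ true
  iso-leaf n e with spine-neighbour a′ n (adj-image {v = leafVtx a n e} (inj₁ par-nd) (iso-spine n))
  ... | inj₁ e′             = ⊥-elim (leaf≢parent a n e n (to-injective (trans e′ (sym (iso-parent n)))))
  ... | inj₂ (inj₁ e′)      =
    ⊥-elim (leaf≢spine a n e (suc n) (to-injective (trans e′ (sym (iso-spine (suc n))))))
  ... | inj₂ (inj₂ (e′ , _)) = e′

comb-iso⇒≡ : ∀ {a a′} → Iso (comb a) (comb a′) → ∀ n → a n ≡ a′ n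
comb-iso⇒≡ I n = ⇔→≡ (mk⇔ (iso-leaf I n) (iso-leaf (Iso-sym I) n))

proposition15 : Σ (ℕ → Bool) λ e → Σ ((ℕ → Bool) → Tree) λ F →
                  (∀ a → EscSeq (F a) zeroConfig e)
                  × (∀ a a' → Iso (F a) (F a') → ∀ n → a n ≡ a' n)
proposition15 = escapeSeq , comb , comb-escapeSeq , λ _ _ → comb-iso⇒≡
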